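{- Let $w\in\mathcal{P}$. If $|w|\ge3$, then $\psi^\bullet_w$ is $\boxplus$-indecomposable. If $|w|\ge4$, then $\psi^\circ_w$ is also $\boxplus$-indecomposable.
   Context: Permutations are in one-line notation. A finite point set in the plane with distinct coordinates is order-isomorphic to a unique permutation. A factor of a word is a contiguous subword. Words over $\{\mathsf{u},\mathsf{d},\mathsf{r_u},\mathsf{r_d}\}$: $\rho$ is the morphism $0\mapsto\mathsf{d}\mathsf{r_d}$, $1\mapsto\mathsf{u}\mathsf{r_u}$; $\mathcal{P}$ is the set of all factors (including the empty word) of words $\rho(x)$, $x\in\{0,1\}^*$. For $w=w(1)\cdots w(n)\in\mathcal{P}$ define points $p_0,\dots,p_n$ with distinct coordinates: $p_0$ (the origin) arbitrary; $p_1$ to the right of and above $p_0$ if $w(1)\in\{\mathsf{u},\mathsf{r_u}\}$, to the right of and below $p_0$ if $w(1)\in\{\mathsf{d},\mathsf{r_d}\}$; for $i\ge2$, $p_i$ lies outside the rectangular hull of $\{p_0,\dots,p_{i-1}\}$ and horizontally or vertically between $p_{i-1}$ and the rectangular hull of $\{p_0,\dots,p_{i-2}\}$, above that hull if $w(i)=\mathsf{u}$, below if $w(i)=\mathsf{d}$, to its right if $w(i)\in\{\mathsf{r_u},\mathsf{r_d}\}$. $\psi^\circ_w$ is the permutation order-isomorphic to $\{p_1,\dots,p_n\}$ and $\psi^\bullet_w$ the one order-isomorphic to $\{p_0,\dots,p_n\}$. For $\sigma$ of length $m\ge0$ and $\tau$ of length $n+1\ge1$, $\sigma\boxplus\tau$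 is the permutation of length $m+n$ obtained by inflating the first entry of $\tau$ by $\sigma$: $(\sigma\boxplus\tau)(i)=\sigma(i)+\tau(1)-1$ for $1\le i\le m$; for $m<i\le m+n$, $(\sigma\boxplus\tau)(i)=\tau(i-m+1)$ if $\tau(i-m+1)<\tau(1)$ and $\tau(i-m+1)+m-1$ otherwise. A permutation is $\boxplus$-decomposable if it equals $\sigma\boxplus\tau$ for permutations $\sigma,\tau$ both of length at least $2$, and $\boxplus$-indecomposable otherwise. -}

module Defs where

open import Data.Nat using (ℕ; zero; suc; _+_; _∸_; _<_; _≤_; _⊔_; _⊓_; _<ᵇ_)
open import Data.Bool using (Bool; true; false; if_then_else_)
open import Data.List using (List; []; _∷_; _++_; map; length; upTo; lookup)
open import Data.Fin using (Fin; toℕ)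
open import Data.Product using (_×_; Σ; ∃; proj₁; proj₂; _,_)
open import Data.Sum using (_⊎_)
open import Data.Unit using (⊤)
open import Relation.Nullary using (¬_)
open import Relation.Binary.PropositionalEquality using (_≡_; _≢_)
open import Data.List.Relation.Binary.Permutation.Propositional using (_↭_)
open import Function.Bundles using (_⇔_)

data Letter : Set where
  u d rᵤ r_d : Letter

-- ρ : 0 ↦ d r_d , 1 ↦ u rᵤ ; a binary word is a List Bool (false = 0, true = 1)
ρ₁ : Bool → List Letter
ρ₁ false = d ∷ r_d ∷ []
ρ₁ true  = u ∷ rᵤ ∷ []

ρ : List Bool → List Letter
ρ []       = []
ρ (b ∷ bs) = ρ₁ b ++ ρ bs

In𝒫 : List Letter → Set
In𝒫 w = Σ (List Bool) λ x → Σ (List Letter) λ a → Σ (List Letter) λ b →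
          a ++ (w ++ b) ≡ ρ x

-- Points in the plane (natural-number coordinates; only the order matters)

Point : Set
Point = ℕ × ℕ

X : Point → ℕ
X = proj₁

Y : Point → ℕ
Y = proj₂

maxUpTo : (ℕ → ℕ) → ℕ → ℕ
maxUpTo f zero    = f zero
maxUpTo f (suc k) = f (suc k) ⊔ maxUpTo f k

minUpTo : (ℕ → ℕ) → ℕ → ℕ
minUpTo f zero    = f zero
minUpTo f (suc k) = f (suc k) ⊓ minUpTo f k

maxX maxY minX minY : (ℕ → Point) → ℕ → ℕ
maxX p = maxUpTo (λ i → X (p i))
maxY p = maxUpTo (λ i → Y (p i))
minX p = minUpTo (λ i → X (p i))
minY p = minUpTo (λ i → Y (p i))

OutsideHull : (ℕ → Point) → ℕ → Point → Set
OutsideHull p k q =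
  (X q < minX p k) ⊎ (maxX p k < X q) ⊎ (Y q < minY p k) ⊎ (maxY p k < Y q)

-- coordinate c lies strictly between coordinate a (of the previous point)
-- and the interval [lo , hi] (the extent of a hull)
Between : ℕ → ℕ → ℕ → ℕ → Set
Between a lo hi c = (hi < c × c < a) ⊎ (a < c × c < lo)

FirstStep : Letter → (ℕ → Point) → Set
FirstStep u   p = (X (p 0) < X (p 1)) × (Y (p 0) < Y (p 1))
FirstStep rᵤ  p = (X (p 0) < X (p 1)) × (Y (p 0) < Y (p 1))
FirstStep d   p = (X (p 0) < X (p 1)) × (Y (p 1) < Y (p 0))
FirstStep r_d p = (X (p 0) < X (p 1)) × (Y (p 1) < Y (p 0))

-- Step l k p : conditions on the point p (suc k) (for k ≥ 1), given letter l:
-- outside hull{p 0..p k}, separating p k from hull{p 0..p (k-1)},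
-- above / below / to the right of hull{p 0..p (k-1)}.
Step : Letter → ℕ → (ℕ → Point) → Set
Step u k p = OutsideHull p k (p (suc k))
  × (maxY p (k ∸ 1) < Y (p (suc k)))
  × Between (X (p k)) (minX p (k ∸ 1)) (maxX p (k ∸ 1)) (X (p (suc k)))
Step d k p = OutsideHull p k (p (suc k))
  × (Y (p (suc k)) < minY p (k ∸ 1))
  × Between (X (p k)) (minX p (k ∸ 1)) (maxX p (k ∸ 1)) (X (p (suc k)))
Step rᵤ k p = OutsideHull p k (p (suc k))
  × (maxX p (k ∸ 1) < X (p (suc k)))
  × Between (Y (p k)) (minY p (k ∸ 1)) (maxY p (k ∸ 1)) (Y (p (suc k)))
Step r_d k p = OutsideHull p k (p (suc k))
  × (maxX p (k ∸ 1) < X (p (suc k)))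
  × Between (Y (p k)) (minY p (k ∸ 1)) (maxY p (k ∸ 1)) (Y (p (suc k)))

DistinctCoords : ℕ → (ℕ → Point) → Set
DistinctCoords n p = ∀ i j → i ≤ n → j ≤ n → i ≢ j →
  (X (p i) ≢ X (p j)) × (Y (p i) ≢ Y (p j))

FirstOK : List Letter → (ℕ → Point) → Set
FirstOK []      p = ⊤
FirstOK (l ∷ _) p = FirstStep l p

Realizes : List Letter → (ℕ → Point) → Set
Realizes w p = DistinctCoords (length w) p × FirstOK w p ×
  (∀ (i : Fin (length w)) → 1 ≤ toℕ i → Step (lookup w i) (toℕ i) p)

pointsBullet pointsCirc : List Letter → (ℕ → Point) → List Point
pointsBullet w p = map p (upTo (suc (length w)))
pointsCirc   w p = map p (map suc (upTo (length w)))

IsPerm : List ℕ → Set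
IsPerm π = π ↭ map suc (upTo (length π))

-- total indexing (default 0; only used in range)
_!_ : {A : Set} → List A → ℕ → A → A
([] ! i) z          = z
((a ∷ as) ! zero) z = a
((a ∷ as) ! suc i) z = (as ! i) z

_!ℕ_ : List ℕ → ℕ → ℕ
xs !ℕ i = (xs ! i) 0

_!P_ : List Point → ℕ → Point
qs !P i = (qs ! i) (0 , 0)

-- π is order-isomorphic to the point set ps (listed in any order):
-- listing the points by increasing x, the relative order of the entries
-- of π equals the relative order of the y-coordinates.
OrderIso : List ℕ → List Point → Set
OrderIso π ps = IsPerm π × length π ≡ length ps ×
  Σ (List Point) λ qs → (qs ↭ ps) ×
    (∀ i j → i < j → j < length qs → X (qs !P i) < X (qs !P j)) ×
    (∀ i j → i < length qs → j < length qs →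
       (π !ℕ i < π !ℕ j) ⇔ (Y (qs !P i) < Y (qs !P j)))

-- σ ⊞ τ : inflate the first entry of τ by σ
_⊞_ : List ℕ → List ℕ → List ℕ
σ ⊞ []       = []
σ ⊞ (t ∷ ts) =
  map (λ s → s + t ∸ 1) σ ++
  map (λ v → if v <ᵇ t then v else v + length σ ∸ 1) ts

⊞-Decomposable : List ℕ → Set
⊞-Decomposable π = Σ (List ℕ) λ σ → Σ (List ℕ) λ τ →
  IsPerm σ × IsPerm τ × 2 ≤ length σ × 2 ≤ length τ × π ≡ σ ⊞ τ

⊞-Indecomposable : List ℕ → Set
⊞-Indecomposable π = ¬ ⊞-Decomposable π

-- A ⊞-decomposition σ ⊞ τ with |σ|, |τ| ≥ 2 shows up in the point set as a
-- vertical line x = T with at least two points on its left and at least one on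
-- its right, such that no point on the right lies vertically strictly between two
-- points on the left (the left points carry the interval of values of σ).
-- For the points p lo, …, p n of a word of 𝒫 (lo = 0 for ψ•, lo = 1 for ψ∘) no
-- such line exists. Let p j be the first point right of the line. Each point from
-- p (j+2) on lies right of the hull of p 0, …, p j, so the left points are among
-- p lo, …, p (j-1) and p (j+1). If j ≥ lo + 2, the step to p j cannot be vertical
-- (p j would lie horizontally between the left points p (j-2) and p (j-1)), so it
-- is horizontal and p j separates them vertically. Otherwise j = lo + 1 and
-- p (j+1) is left of the line; the step to it went back across the line, so it is
-- vertical, in 𝒫 the next letter is horizontal, and p (j+2), right of the line,
-- separates p (j-1) and p (j+1).

module Submission where

open import Defs
open import Data.Nat using (ℕ; zero; suc; _+_; _∸_; _<_; _≤_; _<ᵇ_; z≤n; s≤s; _<?_; _≤?_)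
open import Data.Nat.Properties
open import Data.Bool using (true; false; if_then_else_)
import Data.Bool as Bool
open import Data.Unit using (tt)
open import Data.Fin using (fromℕ<)
open import Data.Fin.Properties using (toℕ-fromℕ<)
open import Data.List.Base using (List; []; _∷_; _++_; map; length; lookup)
open import Data.List.Properties using (length-++; length-map)
open import Data.List.Membership.Propositional using (_∈_)
open import Data.List.Membership.Propositional.Properties using (∈-map⁻; ∈-map⁺; ∈-upTo⁻; ∈-upTo⁺)
open import Data.List.Relation.Unary.Any using (here; there)
open import Data.List.Relation.Unary.Linked using (Linked; []; [-]; _∷_; head; tail)
open import Data.List.Relation.Binary.Permutation.Propositional using (↭-sym)
open import Data.List.Relation.Binary.Permutation.Propositional.Properties using (∈-resp-↭; ↭-length)
open import Data.Product using (_×_; ∃-syntax; proj₁; proj₂; _,_)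
open import Data.Sum using (_⊎_; inj₁; inj₂; [_,_])
open import Data.Empty using (⊥-elim)
open import Function using (_∘_)
open import Function.Bundles using (Equivalence; _⇔_)
open import Level using (0ℓ)
open import Relation.Binary.Core using (Rel)
open import Relation.Binary.Definitions using (tri<; tri≈; tri>)
open import Relation.Nullary using (¬_; yes; no)
open import Relation.Unary using (Pred; Decidable; _⊆_; _≐_)
open import Relation.Binary.PropositionalEquality using (_≡_; _≢_; refl; sym; trans; cong; cong₂; subst; module ≡-Reasoning)

least-witness : {P : Pred ℕ 0ℓ} → Decidable P → ∀ {n} → P n →
                ∃[ j ] j ≤ n × P j × (∀ {i} → i < j → ¬ P i)
least-witness P? {zero} Pn = zero , z≤n , Pn , λ ()
least-witness P? {suc n} Pn with P? zero
... | yes P0 = zero , z≤n , P0 , λ ()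
... | no ¬P0 with least-witness (P? ∘ suc) Pn
...   | j , j≤n , Pj , before = suc j , s≤s j≤n , Pj , λ { {zero} _ → ¬P0 ; {suc i} (s≤s i<j) → before i<j }

module _ {A : Set} {R : Rel A 0ℓ} where

  Linked-++⁻ˡ : ∀ xs {ys} → Linked R (xs ++ ys) → Linked R xs
  Linked-++⁻ˡ []           _  = []
  Linked-++⁻ˡ (x ∷ [])     _  = [-]
  Linked-++⁻ˡ (x ∷ y ∷ xs) rs = head rs ∷ Linked-++⁻ˡ (y ∷ xs) (tail rs)

  Linked-++⁻ʳ : ∀ xs {ys} → Linked R (xs ++ ys) → Linked R ys
  Linked-++⁻ʳ []       rs = rs
  Linked-++⁻ʳ (x ∷ xs) rs = Linked-++⁻ʳ xs (tail rs)

  Linked-lookup : ∀ {xs k} (h : suc k < length xs) → Linked R xs →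
                  R (lookup xs (fromℕ< (<⇒≤ h))) (lookup xs (fromℕ< h))
  Linked-lookup {_ ∷ []}     {zero}  (s≤s ()) _
  Linked-lookup {x ∷ y ∷ xs} {zero}  _       rs = head rs
  Linked-lookup {x ∷ y ∷ xs} {suc k} (s≤s h) rs = Linked-lookup h (tail rs)

!-++ˡ : ∀ {A : Set} (xs : List A) {ys i z} → i < length xs → ((xs ++ ys) ! i) z ≡ (xs ! i) z
!-++ˡ (x ∷ xs) {i = zero}  _       = refl
!-++ˡ (x ∷ xs) {i = suc i} (s≤s h) = !-++ˡ xs h

!-++ʳ : ∀ {A : Set} (xs : List A) {ys i z} → length xs ≤ i →
        ((xs ++ ys) ! i) z ≡ (ys ! (i ∸ length xs)) z
!-++ʳ []       _                   = refl
!-++ʳ (x ∷ xs) {i = suc i} (s≤s h) = !-++ʳ xs h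

!-map : ∀ {A B : Set} (f : A → B) xs {i z z′} → i < length xs → (map f xs ! i) z ≡ f ((xs ! i) z′)
!-map f (x ∷ xs) {zero}  _       = refl
!-map f (x ∷ xs) {suc i} (s≤s h) = !-map f xs h

!-∈ : ∀ {A : Set} {xs : List A} {i} z → i < length xs → (xs ! i) z ∈ xs
!-∈ {xs = x ∷ xs} {zero}  _ _       = here refl
!-∈ {xs = x ∷ xs} {suc i} z (s≤s h) = there (!-∈ z h)

∈⇒! : ∀ {A : Set} {x : A} {xs} z → x ∈ xs → ∃[ i ] i < length xs × (xs ! i) z ≡ x
∈⇒! z (here refl) = zero , s≤s z≤n , refl
∈⇒! z (there x∈) with ∈⇒! z x∈
... | i , i< , xs!i≡x = suc i , s≤s i< , xs!i≡x

-- ⊞-decompositions as vertical cuts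

StrictlyBetween : ℕ → ℕ → ℕ → Set
StrictlyBetween a c b = (a < c × c < b) ⊎ (b < c × c < a)

between-< : ∀ {a b c h} → StrictlyBetween a c b → a ≤ h → b ≤ h → c < h
between-< (inj₁ (_ , c<b)) _   b≤h = <-≤-trans c<b b≤h
between-< (inj₂ (_ , c<a)) a≤h _   = <-≤-trans c<a a≤h

between-> : ∀ {a b c h} → StrictlyBetween a c b → h ≤ a → h ≤ b → h < c
between-> (inj₁ (a<c , _)) h≤a _   = ≤-<-trans h≤a a<c
between-> (inj₂ (b<c , _)) _   h≤b = ≤-<-trans h≤b b<c

shift : ℕ → ℕ → ℕ → ℕ
shift t m v = if v <ᵇ t then v else v + m ∸ 1

shift-gap : ∀ t m v {a b} → b < m → ¬ (a + t < shift t m v × shift t m v < b + t)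
shift-gap t (suc m) v {b = b} b<m (a+t<v′ , v′<b+t) with v <ᵇ t in v<ᵇt
... | true  = <-asym (<ᵇ⇒< v t (subst Bool.T (sym v<ᵇt) tt)) (≤-<-trans (m≤n+m t _) a+t<v′)
... | false = <⇒≱ v′<b+t (subst (b + t ≤_) (sym (cong (_∸ 1) (+-suc v m)))
                (≤-trans (+-mono-≤ (≤-pred b<m) t≤v) (≤-reflexive (+-comm m v))))
  where
  t≤v : t ≤ v
  t≤v = ≮⇒≥ (λ v<t → subst Bool.T v<ᵇt (<⇒<ᵇ v<t))

module _ (σ : List ℕ) (t : ℕ) (ts : List ℕ) where

  ⊞-length : length (σ ⊞ (t ∷ ts)) ≡ length σ + length ts
  ⊞-length = trans (length-++ (map _ σ)) (cong₂ _+_ (length-map _ σ) (length-map _ ts))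

  ⊞-initial : IsPerm σ → ∀ {i} → i < length σ → ∃[ y ] y < length σ × (σ ⊞ (t ∷ ts)) !ℕ i ≡ y + t
  ⊞-initial σ-perm {i} i<m with ∈-map⁻ suc (∈-resp-↭ σ-perm (!-∈ 0 i<m))
  ... | y , y∈ , σ!i≡1+y = y , ∈-upTo⁻ y∈ , (begin
    (σ ⊞ (t ∷ ts)) !ℕ i    ≡⟨ !-++ˡ (map lift σ) (subst (i <_) (sym (length-map lift σ)) i<m) ⟩
    (map lift σ ! i) 0     ≡⟨ !-map lift σ i<m ⟩
    lift (σ !ℕ i)          ≡⟨ cong lift σ!i≡1+y ⟩
    y + t                  ∎)
    where
    open ≡-Reasoning
    lift : ℕ → ℕ
    lift s = s + t ∸ 1

  ⊞-later : ∀ {k} → length σ ≤ k → k < length σ + length ts →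
            (σ ⊞ (t ∷ ts)) !ℕ k ≡ shift t (length σ) (ts !ℕ (k ∸ length σ))
  ⊞-later {k} m≤k k<len = begin
    (σ ⊞ (t ∷ ts)) !ℕ k                          ≡⟨ !-++ʳ (map lift σ) |lift-σ|≤k ⟩
    (map jump ts ! (k ∸ length (map lift σ))) 0  ≡⟨ cong (λ l → (map jump ts ! (k ∸ l)) 0) (length-map lift σ) ⟩
    (map jump ts ! (k ∸ length σ)) 0             ≡⟨ !-map jump ts k∸m<|ts| ⟩
    jump (ts !ℕ (k ∸ length σ))                  ∎
    where
    open ≡-Reasoning
    lift jump : ℕ → ℕ
    lift s = s + t ∸ 1
    jump = shift t (length σ)
    |lift-σ|≤k : length (map lift σ) ≤ k
    |lift-σ|≤k = subst (_≤ k) (sym (length-map lift σ)) m≤k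
    k∸m<|ts| : k ∸ length σ < length ts
    k∸m<|ts| = subst (k ∸ length σ <_) (m+n∸m≡n (length σ) (length ts)) (∸-monoˡ-< k<len m≤k)

  ⊞-interval : IsPerm σ → ∀ {i j k} → i < length σ → j < length σ →
    length σ ≤ k → k < length σ + length ts →
    ¬ StrictlyBetween ((σ ⊞ (t ∷ ts)) !ℕ i) ((σ ⊞ (t ∷ ts)) !ℕ k) ((σ ⊞ (t ∷ ts)) !ℕ j)
  ⊞-interval σ-perm i<m j<m m≤k k<len
    with ⊞-initial σ-perm i<m | ⊞-initial σ-perm j<m
  ... | a , a<m , π!i≡ | b , b<m , π!j≡
    rewrite π!i≡ | π!j≡ | ⊞-later m≤k k<len = [ shift-gap t _ _ b<m , shift-gap t _ _ a<m ]

IntervalCut : Pred Point 0ℓ → ℕ → Set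
IntervalCut S T = ∀ {a b c} → S a → S b → S c →
  X a ≤ T → X b ≤ T → T < X c → ¬ StrictlyBetween (Y a) (Y c) (Y b)

record ProperCut (S : Pred Point 0ℓ) : Set where
  field
    T           : ℕ
    {q₁ q₂ q₃}  : Point
    q₁∈S        : S q₁
    q₂∈S        : S q₂
    q₃∈S        : S q₃
    q₁<q₂       : X q₁ < X q₂
    q₂≤T        : X q₂ ≤ T
    T<q₃        : T < X q₃
    intervalCut : IntervalCut S T

ProperCut-resp : ∀ {S S′} → S ≐ S′ → ProperCut S → ProperCut S′
ProperCut-resp (S⊆S′ , S′⊆S) cut = record
  { T = T ; q₁∈S = S⊆S′ q₁∈S ; q₂∈S = S⊆S′ q₂∈S ; q₃∈S = S⊆S′ q₃∈S
  ; q₁<q₂ = q₁<q₂ ; q₂≤T = q₂≤T ; T<q₃ = T<q₃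
  ; intervalCut = λ a b c → intervalCut (S′⊆S a) (S′⊆S b) (S′⊆S c)
  }
  where open ProperCut cut

SortedByX : List Point → Set
SortedByX qs = ∀ i j → i < j → j < length qs → X (qs !P i) < X (qs !P j)

module _ (qs : List Point) (sorted : SortedByX qs) where

  sorted-≤ : ∀ {i j} → i ≤ j → j < length qs → X (qs !P i) ≤ X (qs !P j)
  sorted-≤ i≤j j< with m≤n⇒m<n∨m≡n i≤j
  ... | inj₁ i<j  = <⇒≤ (sorted _ _ i<j j<)
  ... | inj₂ refl = ≤-refl

  sorted-≤⁻ : ∀ {i j} → i < length qs → X (qs !P i) ≤ X (qs !P j) → i ≤ j
  sorted-≤⁻ i< xi≤xj = ≮⇒≥ (λ j<i → <⇒≱ (sorted _ _ j<i i<) xi≤xj)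

  sorted-<⁻ : ∀ {i j} → i < length qs → X (qs !P i) < X (qs !P j) → i < j
  sorted-<⁻ i< xi<xj = ≰⇒> (λ j≤i → <⇒≱ xi<xj (sorted-≤ j≤i i<))

SameYOrder : List ℕ → List Point → Set
SameYOrder π qs = ∀ i j → i < length qs → j < length qs →
  (π !ℕ i < π !ℕ j) ⇔ (Y (qs !P i) < Y (qs !P j))

sameYOrder-between : ∀ {π qs} → SameYOrder π qs → ∀ {i j k} →
  i < length qs → j < length qs → k < length qs →
  StrictlyBetween (Y (qs !P i)) (Y (qs !P k)) (Y (qs !P j)) → StrictlyBetween (π !ℕ i) (π !ℕ k) (π !ℕ j)
sameYOrder-between order i< j< k< (inj₁ (i<k , k<j)) =
  inj₁ (Equivalence.from (order _ _ i< k<) i<k , Equivalence.from (order _ _ k< j<) k<j)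
sameYOrder-between order i< j< k< (inj₂ (j<k , k<i)) =
  inj₂ (Equivalence.from (order _ _ j< k<) j<k , Equivalence.from (order _ _ k< i<) k<i)

⊞-decomposable⇒properCut : ∀ {π ps} → OrderIso π ps → ⊞-Decomposable π → ProperCut (_∈ ps)
⊞-decomposable⇒properCut _ ([] , _ , _ , _ , () , _)
⊞-decomposable⇒properCut _ (_ ∷ _ , [] , _ , _ , _ , () , _)
⊞-decomposable⇒properCut _ (_ ∷ _ , _ ∷ [] , _ , _ , _ , s≤s () , _)
⊞-decomposable⇒properCut {ps = ps} (_ , |π|≡|ps| , qs , qs↭ps , sorted , order)
                         (σ@(_ ∷ σ′) , t ∷ t′ ∷ ts , σ-perm , _ , s≤s 1≤last , _ , refl) = record
  { T = X (qs !P last)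
  ; q₁∈S = member 0<|qs| ; q₂∈S = member 1<|qs| ; q₃∈S = member m<|qs|
  ; q₁<q₂ = sorted 0 1 (s≤s z≤n) 1<|qs|
  ; q₂≤T = sorted-≤ qs sorted 1≤last last<|qs|
  ; T<q₃ = sorted last m ≤-refl m<|qs|
  ; intervalCut = interval
  }
  where
  m last : ℕ
  m = length σ
  last = length σ′
  |qs|≡ : length qs ≡ m + length (t′ ∷ ts)
  |qs|≡ = trans (↭-length qs↭ps) (trans (sym |π|≡|ps|) (⊞-length σ t (t′ ∷ ts)))
  m<|qs| : m < length qs
  m<|qs| = subst (m <_) (sym |qs|≡) (m<m+n m (s≤s z≤n))
  last<|qs| : last < length qs
  last<|qs| = <-trans ≤-refl m<|qs|
  1<|qs| : 1 < length qs
  1<|qs| = <-trans (s≤s 1≤last) m<|qs|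
  0<|qs| : 0 < length qs
  0<|qs| = <-trans (s≤s z≤n) 1<|qs|
  member : ∀ {i} → i < length qs → qs !P i ∈ ps
  member i< = ∈-resp-↭ qs↭ps (!-∈ (0 , 0) i<)
  index : ∀ {q} → q ∈ ps → ∃[ i ] i < length qs × qs !P i ≡ q
  index q∈ = ∈⇒! (0 , 0) (∈-resp-↭ (↭-sym qs↭ps) q∈)
  interval : IntervalCut (_∈ ps) (X (qs !P last))
  interval a∈ b∈ c∈ a≤T b≤T T<c between with index a∈ | index b∈ | index c∈
  ... | i , i< , refl | j , j< , refl | k , k< , refl =
    ⊞-interval σ t (t′ ∷ ts) σ-perm
      (s≤s (sorted-≤⁻ qs sorted i< a≤T)) (s≤s (sorted-≤⁻ qs sorted j< b≤T))
      (sorted-<⁻ qs sorted last<|qs| T<c) (subst (k <_) |qs|≡ k<)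
      (sameYOrder-between {σ ⊞ (t ∷ t′ ∷ ts)} {qs} order i< j< k< between)

-- The language 𝒫

data IsVertical : Letter → Set where
  u : IsVertical u
  d : IsVertical d

data IsHorizontal : Letter → Set where
  rᵤ  : IsHorizontal rᵤ
  r_d : IsHorizontal r_d

vertical-or-horizontal : ∀ l → IsVertical l ⊎ IsHorizontal l
vertical-or-horizontal u   = inj₁ u
vertical-or-horizontal d   = inj₁ d
vertical-or-horizontal rᵤ  = inj₂ rᵤ
vertical-or-horizontal r_d = inj₂ r_d

horizontal⇒¬vertical : ∀ {l} → IsHorizontal l → ¬ IsVertical l
horizontal⇒¬vertical rᵤ  ()
horizontal⇒¬vertical r_d ()

HorizontalAfterVertical : Rel Letter 0ℓ
HorizontalAfterVertical l l′ = IsVertical l → IsHorizontal l′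

horizontal-∷ : ∀ {l ls} → IsHorizontal l → Linked HorizontalAfterVertical ls →
               Linked HorizontalAfterVertical (l ∷ ls)
horizontal-∷ h []         = [-]
horizontal-∷ h rs@[-]     = (⊥-elim ∘ horizontal⇒¬vertical h) ∷ rs
horizontal-∷ h rs@(_ ∷ _) = (⊥-elim ∘ horizontal⇒¬vertical h) ∷ rs

ρ-linked : ∀ x → Linked HorizontalAfterVertical (ρ x)
ρ-linked []          = []
ρ-linked (false ∷ x) = (λ _ → r_d) ∷ horizontal-∷ r_d (ρ-linked x)
ρ-linked (true ∷ x)  = (λ _ → rᵤ) ∷ horizontal-∷ rᵤ (ρ-linked x)

𝒫-linked : ∀ {w} → In𝒫 w → Linked HorizontalAfterVertical w
𝒫-linked {w} (x , a , b , a++w++b≡ρx) =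
  Linked-++⁻ˡ w (Linked-++⁻ʳ a (subst (Linked _) (sym a++w++b≡ρx) (ρ-linked x)))

-- Geometry of the construction

maxUpTo-mono : ∀ f {k k′} → k ≤ k′ → maxUpTo f k ≤ maxUpTo f k′
maxUpTo-mono f {k′ = zero} z≤n = ≤-refl
maxUpTo-mono f {k′ = suc k′} k≤ with m≤n⇒m<n∨m≡n k≤
... | inj₁ (s≤s k≤k′) = ≤-trans (maxUpTo-mono f k≤k′) (m≤n⊔m _ _)
... | inj₂ refl       = ≤-refl

minUpTo-antitone : ∀ f {k k′} → k ≤ k′ → minUpTo f k′ ≤ minUpTo f k
minUpTo-antitone f {k′ = zero} z≤n = ≤-refl
minUpTo-antitone f {k′ = suc k′} k≤ with m≤n⇒m<n∨m≡n k≤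
... | inj₁ (s≤s k≤k′) = ≤-trans (m⊓n≤n _ _) (minUpTo-antitone f k≤k′)
... | inj₂ refl       = ≤-refl

≤-maxUpTo : ∀ f k {i} → i ≤ k → f i ≤ maxUpTo f k
≤-maxUpTo f k {zero}  i≤k = maxUpTo-mono f i≤k
≤-maxUpTo f k {suc i} i≤k = ≤-trans (m≤m⊔n _ _) (maxUpTo-mono f i≤k)

minUpTo-≤ : ∀ f k {i} → i ≤ k → minUpTo f k ≤ f i
minUpTo-≤ f k {zero}  i≤k = minUpTo-antitone f i≤k
minUpTo-≤ f k {suc i} i≤k = ≤-trans (minUpTo-antitone f i≤k) (m⊓n≤m _ _)

between-hull : ∀ f {k i a c} → Between a (minUpTo f k) (maxUpTo f k) c → i ≤ k →
               StrictlyBetween (f i) c a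
between-hull f {k} (inj₁ (hi<c , c<a)) i≤k = inj₁ (≤-<-trans (≤-maxUpTo f k i≤k) hi<c , c<a)
between-hull f {k} (inj₂ (a<c , c<lo)) i≤k = inj₂ (a<c , <-≤-trans c<lo (minUpTo-≤ f k i≤k))

between-hull-inside : ∀ f {k c} → Between (f (suc k)) (minUpTo f k) (maxUpTo f k) c →
                      minUpTo f (suc k) < c × c < maxUpTo f (suc k)
between-hull-inside f {k} {c} between =
    between-> k-and-k+1 (minUpTo-≤ f (suc k) (n≤1+n k)) (minUpTo-≤ f (suc k) ≤-refl)
  , between-< k-and-k+1 (≤-maxUpTo f (suc k) (n≤1+n k)) (≤-maxUpTo f (suc k) ≤-refl)
  where
  k-and-k+1 : StrictlyBetween (f k) c (f (suc k))
  k-and-k+1 = between-hull f between ≤-refl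

VerticalMove HorizontalMove : ℕ → (ℕ → Point) → Set
VerticalMove k p = Between (X (p k)) (minX p (k ∸ 1)) (maxX p (k ∸ 1)) (X (p (suc k)))
HorizontalMove k p = OutsideHull p k (p (suc k))
  × (maxX p (k ∸ 1) < X (p (suc k)))
  × Between (Y (p k)) (minY p (k ∸ 1)) (maxY p (k ∸ 1)) (Y (p (suc k)))

vertical-move : ∀ {l k p} → IsVertical l → Step l k p → VerticalMove k p
vertical-move u (_ , _ , between) = between
vertical-move d (_ , _ , between) = between

horizontal-move : ∀ {l k p} → IsHorizontal l → Step l k p → HorizontalMove k p
horizontal-move rᵤ  step = step
horizontal-move r_d step = step

move : ∀ l {k p} → Step l k p → VerticalMove k p ⊎ HorizontalMove k p
move l step with vertical-or-horizontal l
... | inj₁ v = inj₁ (vertical-move v step)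
... | inj₂ h = inj₂ (horizontal-move h step)

horizontal-clears-hull : ∀ {k p} → HorizontalMove (suc k) p → maxX p (suc k) < X (p (suc (suc k)))
horizontal-clears-hull {k} {p} (outside , right , between) with outside
... | inj₁ left = ⊥-elim (<-asym left
        (≤-<-trans (minUpTo-≤ (X ∘ p) (suc k) z≤n) (≤-<-trans (≤-maxUpTo (X ∘ p) k z≤n) right)))
... | inj₂ (inj₁ beyond)       = beyond
... | inj₂ (inj₂ (inj₁ below)) = ⊥-elim (<-asym below (proj₁ (between-hull-inside (Y ∘ p) between)))
... | inj₂ (inj₂ (inj₂ above)) = ⊥-elim (<-asym above (proj₂ (between-hull-inside (Y ∘ p) between)))

firstStep-right : ∀ l {p} → FirstStep l p → X (p 0) < X (p 1)
firstStep-right u   = proj₁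
firstStep-right d   = proj₁
firstStep-right rᵤ  = proj₁
firstStep-right r_d = proj₁

firstOK-right : ∀ w {p} → 1 ≤ length w → FirstOK w p → X (p 0) < X (p 1)
firstOK-right (l ∷ _) _ = firstStep-right l

Segment : (ℕ → Point) → ℕ → ℕ → Pred Point 0ℓ
Segment p lo n q = ∃[ i ] lo ≤ i × i ≤ n × p i ≡ q

near-crossing-index : ∀ {lo j s₁ s₂} → lo ≤ s₁ → lo ≤ s₂ → s₁ ≢ s₂ → j ≤ suc lo →
  s₁ < j ⊎ s₁ ≡ suc j → s₂ < j ⊎ s₂ ≡ suc j → j ≡ suc lo × (s₁ ≡ suc j ⊎ s₂ ≡ suc j)
near-crossing-index {lo} {j} lo≤s₁ lo≤s₂ s₁≢s₂ j≤ (inj₁ s₁<j) (inj₁ s₂<j) =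
  ⊥-elim (s₁≢s₂ (trans (squeeze lo≤s₁ s₁<j) (sym (squeeze lo≤s₂ s₂<j))))
  where
  squeeze : ∀ {s} → lo ≤ s → s < j → s ≡ lo
  squeeze lo≤s s<j = ≤-antisym (≤-pred (≤-trans s<j j≤)) lo≤s
near-crossing-index lo≤s₁ _ _ j≤ (inj₁ s₁<j) (inj₂ s₂≡) = ≤-antisym j≤ (≤-trans (s≤s lo≤s₁) s₁<j) , inj₂ s₂≡
near-crossing-index _ lo≤s₂ _ j≤ (inj₂ s₁≡) (inj₁ s₂<j) = ≤-antisym j≤ (≤-trans (s≤s lo≤s₂) s₂<j) , inj₁ s₁≡
near-crossing-index _ _ s₁≢s₂ _ (inj₂ s₁≡) (inj₂ s₂≡) = ⊥-elim (s₁≢s₂ (trans s₁≡ (sym s₂≡)))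

module Realization {w : List Letter} {p : ℕ → Point} (R : Realizes w p) where

  stepAt : ∀ {k} (h : k < length w) → 1 ≤ k → Step (lookup w (fromℕ< h)) k p
  stepAt h 1≤k = subst (λ k → Step (lookup w (fromℕ< h)) k p) (toℕ-fromℕ< h)
    (proj₂ (proj₂ R) (fromℕ< h) (subst (1 ≤_) (sym (toℕ-fromℕ< h)) 1≤k))

  moveAt : ∀ {k} → suc k < length w → VerticalMove (suc k) p ⊎ HorizontalMove (suc k) p
  moveAt h = move _ (stepAt h (s≤s z≤n))

  move-clears-hull : ∀ {k} → suc k < length w → X (p 0) < X (p (suc k)) →
                     maxX p k < X (p (suc (suc k)))
  move-clears-hull {k} h origin< with moveAt h
  ... | inj₁ (inj₁ (hi<c , _)) = hi<c
  ... | inj₁ (inj₂ (a<c , c<lo)) =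
    ⊥-elim (<-asym origin< (<-trans a<c (<-≤-trans c<lo (minUpTo-≤ (X ∘ p) k z≤n))))
  ... | inj₂ (_ , right , _) = right

  origin-leftmost : ∀ {i} → 1 ≤ i → i ≤ length w → X (p 0) < X (p i)
  origin-leftmost {1}           _ h = firstOK-right w h (proj₁ (proj₂ R))
  origin-leftmost {suc (suc k)} _ h =
    ≤-<-trans (≤-maxUpTo (X ∘ p) k z≤n) (move-clears-hull h (origin-leftmost (s≤s z≤n) (<⇒≤ h)))

  clears-hull : ∀ {k i} → suc (suc k) ≤ i → i ≤ length w → maxX p k < X (p i)
  clears-hull {k} {suc (suc i)} (s≤s (s≤s k≤i)) h =
    ≤-<-trans (maxUpTo-mono (X ∘ p) k≤i) (move-clears-hull h (origin-leftmost (s≤s z≤n) (<⇒≤ h)))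

  behind-crossing : ∀ {i j T} → i ≤ length w → X (p i) ≤ T → T < X (p j) → i < j ⊎ i ≡ suc j
  behind-crossing {i} {j} i≤n left right with <-cmp i j
  ... | tri< i<j _ _ = inj₁ i<j
  ... | tri≈ _ refl _ = ⊥-elim (<⇒≱ right left)
  ... | tri> _ _ j<i with m≤n⇒m<n∨m≡n j<i
  ...   | inj₂ refl = inj₂ refl
  ...   | inj₁ j+1<i = ⊥-elim (<⇒≱ (<-trans right
            (≤-<-trans (≤-maxUpTo (X ∘ p) j ≤-refl) (clears-hull j+1<i i≤n))) left)

  crossing-separates : ∀ {k T} → suc k < length w → X (p k) ≤ T → X (p (suc k)) ≤ T →
    T < X (p (suc (suc k))) → StrictlyBetween (Y (p k)) (Y (p (suc (suc k)))) (Y (p (suc k)))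
  crossing-separates {k} h xk≤T xk′≤T T< with moveAt h
  ... | inj₁ vertical = ⊥-elim (<-asym T< (between-< (between-hull (X ∘ p) vertical ≤-refl) xk≤T xk′≤T))
  ... | inj₂ (_ , _ , between) = between-hull (Y ∘ p) between ≤-refl

  backtrack-separates : Linked HorizontalAfterVertical w → ∀ {k T} → suc (suc k) < length w →
    X (p k) ≤ T → T < X (p (suc k)) → X (p (suc (suc k))) ≤ T →
    T < X (p (3 + k)) × StrictlyBetween (Y (p k)) (Y (p (3 + k))) (Y (p (2 + k)))
  backtrack-separates linked {k} h xk≤T T<xk′ xk″≤T
    with vertical-or-horizontal (lookup w (fromℕ< (<⇒≤ h)))
  ... | inj₂ horizontal = ⊥-elim (<-asym T<xk′ (<-≤-trans
          (≤-<-trans (≤-maxUpTo (X ∘ p) (suc k) ≤-refl)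
            (horizontal-clears-hull {k} {p} (horizontal-move horizontal (stepAt (<⇒≤ h) (s≤s z≤n)))))
          xk″≤T))
  ... | inj₁ vertical =
    <-trans T<xk′ (≤-<-trans (≤-maxUpTo (X ∘ p) (suc k) ≤-refl) (clears-hull ≤-refl h)) ,
    between-hull (Y ∘ p) (proj₂ (proj₂ next)) (n≤1+n k)
    where
    next : HorizontalMove (2 + k) p
    next = horizontal-move (Linked-lookup h linked vertical) (stepAt h (s≤s z≤n))

  far-crossing : ∀ {lo T j} → IntervalCut (Segment p lo (length w)) T → 2 + lo ≤ j → j ≤ length w →
                 (∀ {i} → i < j → X (p i) ≤ T) → ¬ T < X (p j)
  far-crossing cut (s≤s (s≤s lo≤k)) j≤n left T<j =
    cut (_ , lo≤k , ≤-trans (n≤1+n _) (<⇒≤ j≤n) , refl)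
        (_ , m≤n⇒m≤1+n lo≤k , <⇒≤ j≤n , refl)
        (_ , m≤n⇒m≤1+n (m≤n⇒m≤1+n lo≤k) , j≤n , refl)
        (left (s≤s (n≤1+n _))) (left ≤-refl) T<j
        (crossing-separates j≤n (left (s≤s (n≤1+n _))) (left ≤-refl) T<j)

  near-crossing : Linked HorizontalAfterVertical w → ∀ {lo T} → IntervalCut (Segment p lo (length w)) T →
    3 + lo ≤ length w → X (p lo) ≤ T → T < X (p (1 + lo)) → ¬ X (p (2 + lo)) ≤ T
  near-crossing linked cut 3+lo≤n x₀≤T T<x₁ x₂≤T
    with backtrack-separates linked 3+lo≤n x₀≤T T<x₁ x₂≤T
  ... | T<x₃ , between =
    cut (_ , ≤-refl , ≤-trans (n≤1+n _) (≤-trans (n≤1+n _) (<⇒≤ 3+lo≤n)) , refl)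
        (_ , m≤n⇒m≤1+n (n≤1+n _) , <⇒≤ 3+lo≤n , refl)
        (_ , m≤n⇒m≤1+n (m≤n⇒m≤1+n (n≤1+n _)) , 3+lo≤n , refl)
        x₀≤T x₂≤T T<x₃ between

  no-proper-cut : Linked HorizontalAfterVertical w → ∀ {lo} → 3 + lo ≤ length w →
                  ¬ ProperCut (Segment p lo (length w))
  no-proper-cut linked {lo} 3+lo≤n record
    { T = T ; q₁∈S = s₁ , lo≤s₁ , s₁≤n , refl ; q₂∈S = s₂ , lo≤s₂ , s₂≤n , refl
    ; q₃∈S = c , _ , c≤n , refl ; q₁<q₂ = x₁<x₂ ; q₂≤T = x₂≤T ; T<q₃ = T<c ; intervalCut = cut }
    with least-witness (λ i → T <? X (p i)) T<c
  ... | j , j≤c , T<j , before-j with 2 + lo ≤? j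
  ...   | yes 2+lo≤j = far-crossing cut 2+lo≤j (≤-trans j≤c c≤n) (≮⇒≥ ∘ before-j) T<j
  ...   | no j≱2+lo
    with near-crossing-index lo≤s₁ lo≤s₂ (λ { refl → <-irrefl refl x₁<x₂ }) (≤-pred (≰⇒> j≱2+lo))
           (behind-crossing s₁≤n (<⇒≤ (<-≤-trans x₁<x₂ x₂≤T)) T<j) (behind-crossing s₂≤n x₂≤T T<j)
  ... | refl , inj₁ refl =
    near-crossing linked cut 3+lo≤n (≮⇒≥ (before-j ≤-refl)) T<j (<⇒≤ (<-≤-trans x₁<x₂ x₂≤T))
  ... | refl , inj₂ refl =
    near-crossing linked cut 3+lo≤n (≮⇒≥ (before-j ≤-refl)) T<j x₂≤T

pointsBullet≐segment : ∀ w p → (_∈ pointsBullet w p) ≐ Segment p 0 (length w)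
pointsBullet≐segment w p = to , from
  where
  to : (_∈ pointsBullet w p) ⊆ Segment p 0 (length w)
  to q∈ with ∈-map⁻ p q∈
  ... | i , i∈ , refl = i , z≤n , ≤-pred (∈-upTo⁻ i∈) , refl
  from : Segment p 0 (length w) ⊆ (_∈ pointsBullet w p)
  from (i , _ , i≤n , refl) = ∈-map⁺ p (∈-upTo⁺ (s≤s i≤n))

pointsCirc≐segment : ∀ w p → (_∈ pointsCirc w p) ≐ Segment p 1 (length w)
pointsCirc≐segment w p = to , from
  where
  to : (_∈ pointsCirc w p) ⊆ Segment p 1 (length w)
  to q∈ with ∈-map⁻ p q∈
  ... | i , i∈ , refl with ∈-map⁻ suc i∈
  ...   | y , y∈ , refl = suc y , s≤s z≤n , ∈-upTo⁻ y∈ , refl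
  from : Segment p 1 (length w) ⊆ (_∈ pointsCirc w p)
  from (suc y , _ , y<n , refl) = ∈-map⁺ p (∈-map⁺ suc (∈-upTo⁺ y<n))

segment-indecomposable : ∀ {w p lo ps π} → Realizes w p → Linked HorizontalAfterVertical w →
  3 + lo ≤ length w → (_∈ ps) ≐ Segment p lo (length w) → OrderIso π ps → ⊞-Indecomposable π
segment-indecomposable R linked 3+lo≤n ps≐segment iso =
  Realization.no-proper-cut R linked 3+lo≤n ∘ ProperCut-resp ps≐segment ∘ ⊞-decomposable⇒properCut iso

lemma6p1 : (w : List Letter) → In𝒫 w →
    (3 ≤ length w → ∀ p → Realizes w p →
       ∀ π → OrderIso π (pointsBullet w p) → ⊞-Indecomposable π)
  × (4 ≤ length w → ∀ p → Realizes w p →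
       ∀ π → OrderIso π (pointsCirc w p) → ⊞-Indecomposable π)
lemma6p1 w w∈𝒫 =
    (λ 3≤n p R _ → segment-indecomposable R linked 3≤n (pointsBullet≐segment w p))
  , (λ 4≤n p R _ → segment-indecomposable R linked 4≤n (pointsCirc≐segment w p))
  where
  linked : Linked HorizontalAfterVertical w
  linked = 𝒫-linked w∈𝒫
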